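{- Consider a discrete-time random walk on the path $\{0,1,\dots,d\}$ starting at node $0$, where from node $i$ it stays at $i$ with probability $\alpha_i$, moves to $i+1$ with probability $\beta_i$ (for $i<d$), and moves to $i-1$ with probability $1-\alpha_i-\beta_i$ (this being $0$ for $i=0$), with $\beta_i>0$ for all $i<d$. If $\alpha_i\ge1/2$ for all nodes $i$, then the first-passage probability $f_{0,d}(t)$ is log-concave in $t$.
   Context: $f_{0,d}(t)$ denotes the probability that the walk started at $0$ visits node $d$ at step $t$ for the first time ($f_{0,d}(0)=0$). A function $f:\mathbb{N}\to\mathbb{R}_{\ge0}$ is log-concave if $f(i)^2\ge f(i-1)f(i+1)$ for all integers $i\ge1$.
   Formalization: The probabilities $\alpha_i$ and $\beta_i$ of staying at node i and moving up from it take rational values. -}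

module Defs where

open import Data.Nat using (ℕ; zero; suc; _<ᵇ_)
open import Data.Bool using (if_then_else_)
open import Data.Rational using (ℚ; 0ℚ; 1ℚ; _+_; _*_; _-_; _≤_)

-- Random walk on the path {0,…,d}; parameters indexed by ℕ (only
-- indices ≤ d resp. < d are ever used):
--   α i : probability to stay at i
--   β i : probability to move from i to i+1 (i < d)
--   1 - α i - β i : probability to move from i to i-1

-- keep value only at nodes j < d (node d is the target, i.e. absorbing)
inside : ℕ → ℕ → ℚ → ℚ
inside d j x = if j <ᵇ d then x else 0ℚ

-- taboo probability: q d α β t j = P(walk from 0 is at node j at step t
-- and has not visited d at steps 0,…,t), for j < d (0 otherwise).
q : (d : ℕ) → (α β : ℕ → ℚ) → ℕ → ℕ → ℚ
q d α β zero    zero    = inside d zero 1ℚ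
q d α β zero    (suc j) = 0ℚ
q d α β (suc t) j =
  inside d j (q d α β t j * α j + fromBelow j
              + q d α β t (suc j) * (1ℚ - α (suc j) - β (suc j)))
  where
  fromBelow : ℕ → ℚ
  fromBelow zero    = 0ℚ
  fromBelow (suc k) = q d α β t k * β k

firstPassage : (d : ℕ) → (α β : ℕ → ℚ) → ℕ → ℚ
firstPassage d       α β zero    = 0ℚ
firstPassage zero    α β (suc t) = 0ℚ
firstPassage (suc k) α β (suc t) = q (suc k) α β t k * β k

LogConcave : (ℕ → ℚ) → Set
LogConcave f = ∀ i → f i * f (suc (suc i)) ≤ f (suc i) * f (suc i)

{-# OPTIONS --safe #-}
-- Let x t be the distribution at time t of the walk killed on hitting d, so that
-- f(t + 1) = β (d - 1) · x t (d - 1).  The killed one-step kernel is tridiagonal and nonnegative,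
-- and α i ≥ ½ makes its adjacent 2 × 2 minors α j α (j + 1) - γ (j + 1) β j nonnegative
-- (γ = 1 - α - β): β j ≤ 1 - α j ≤ ½ ≤ α (j + 1) and γ (j + 1) ≤ 1 - α (j + 1) ≤ ½ ≤ α j.
-- Such a kernel preserves the likelihood-ratio order ≼, and x 0, a point mass at 0, satisfies
-- x 0 ≼ x 1; hence x t ≼ x (t + 1) for every t.  At the absorbing end,
-- x (t + 1) (d - 1)² - x t (d - 1) · x (t + 2) (d - 1) is β (d - 2) times the minor of x t, x (t + 1)
-- at the states d - 2, d - 1 (and 0 if d = 1); up to the factor β (d - 1)² this is log-concavity.
module Submission where

open import Defs
open import Data.Nat using (ℕ; zero; suc)
open import Data.Rational using (ℚ; 0ℚ; 1ℚ; ½; _+_; _≤_; _<_)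
open import Relation.Binary.PropositionalEquality using (_≡_)

import Data.Nat as ℕ
import Data.Nat.Properties as ℕₚ
open import Data.Bool using (true; false)
open import Data.Rational using (_*_; _-_; -_; nonNegative)
import Data.Rational.Properties as ℚₚ
open import Data.Rational.Solver using (module +-*-Solver)
open import Data.Sum using (inj₁; inj₂)
open import Relation.Binary.PropositionalEquality
  using (_≗_; refl; sym; cong; cong₂; subst; subst₂)
open import Relation.Nullary.Negation using (contradiction)
open import Function using (_∘_)

open +-*-Solver using (solve; _:+_; _:*_; _:-_; _:=_; con)
open ℚₚ.≤-Reasoning

p≤q⇒0≤q-p : ∀ {p q} → p ≤ q → 0ℚ ≤ q - p
p≤q⇒0≤q-p {p} {q} p≤q = begin
  0ℚ    ≡⟨ ℚₚ.+-inverseʳ p ⟨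
  p - p ≤⟨ ℚₚ.+-monoˡ-≤ (- p) p≤q ⟩
  q - p ∎

0≤q-p⇒p≤q : ∀ {p q} → 0ℚ ≤ q - p → p ≤ q
0≤q-p⇒p≤q {p} {q} 0≤q-p = begin
  p          ≡⟨ ℚₚ.+-identityˡ p ⟨
  0ℚ + p     ≤⟨ ℚₚ.+-monoˡ-≤ p 0≤q-p ⟩
  q - p + p  ≡⟨ solve 2 (λ q p → q :- p :+ p := q) refl q p ⟩
  q          ∎

0≤p*q : ∀ {p q} → 0ℚ ≤ p → 0ℚ ≤ q → 0ℚ ≤ p * q
0≤p*q {p} {q} 0≤p 0≤q =
  ℚₚ.nonNegative⁻¹ _ {{ℚₚ.nonNeg*nonNeg⇒nonNeg p {{nonNegative 0≤p}} q {{nonNegative 0≤q}}}}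

0≤p+q : ∀ {p q} → 0ℚ ≤ p → 0ℚ ≤ q → 0ℚ ≤ p + q
0≤p+q {p} {q} 0≤p 0≤q =
  ℚₚ.nonNegative⁻¹ _ {{ℚₚ.nonNeg+nonNeg⇒nonNeg p {{nonNegative 0≤p}} q {{nonNegative 0≤q}}}}

½≤p⇒1-p≤½ : ∀ {p} → ½ ≤ p → 1ℚ - p ≤ ½
½≤p⇒1-p≤½ {p} ½≤p = 0≤q-p⇒p≤q (begin
  0ℚ               ≤⟨ p≤q⇒0≤q-p ½≤p ⟩
  p - ½            ≡⟨ solve 1 (λ p → p :- con ½ := con ½ :- (con 1ℚ :- p)) refl p ⟩
  ½ - (1ℚ - p)     ∎)

*-mono-≤-nonNeg : ∀ {p q r s} → 0ℚ ≤ p → 0ℚ ≤ r → p ≤ q → r ≤ s → p * r ≤ q * s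
*-mono-≤-nonNeg {p} {q} {r} {s} 0≤p 0≤r p≤q r≤s = begin
  p * r ≤⟨ ℚₚ.*-monoʳ-≤-nonNeg r {{nonNegative 0≤r}} p≤q ⟩
  q * r ≤⟨ ℚₚ.*-monoˡ-≤-nonNeg q {{nonNegative (ℚₚ.≤-trans 0≤p p≤q)}} r≤s ⟩
  q * s ∎

p+q≤r⇒q≤r-p : ∀ {p q r} → p + q ≤ r → q ≤ r - p
p+q≤r⇒q≤r-p {p} {q} {r} p+q≤r = 0≤q-p⇒p≤q (begin
  0ℚ            ≤⟨ p≤q⇒0≤q-p p+q≤r ⟩
  r - (p + q)   ≡⟨ solve 3 (λ p q r → r :- (p :+ q) := r :- p :- q) refl p q r ⟩
  r - p - q     ∎)

p+q≤r⇒0≤r-p-q : ∀ {p q r} → p + q ≤ r → 0ℚ ≤ r - p - q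
p+q≤r⇒0≤r-p-q {p} {q} {r} p+q≤r = p≤q⇒0≤q-p (p+q≤r⇒q≤r-p p+q≤r)

0≤q⇒r-p-q≤r-p : ∀ {p q r} → 0ℚ ≤ q → r - p - q ≤ r - p
0≤q⇒r-p-q≤r-p {p} {q} {r} 0≤q = 0≤q-p⇒p≤q (begin
  0ℚ                   ≤⟨ 0≤q ⟩
  q                    ≡⟨ solve 3 (λ p q r → q := r :- p :- (r :- p :- q)) refl p q r ⟩
  r - p - (r - p - q)  ∎)

minor : (ℕ → ℚ) → (ℕ → ℚ) → ℕ → ℕ → ℚ
minor x y u v = x u * y v - x v * y u

-- The likelihood-ratio order: y / x is nondecreasing.
_≼_ : (ℕ → ℚ) → (ℕ → ℚ) → Set
x ≼ y = ∀ {u v} → u ℕ.< v → 0ℚ ≤ minor x y u v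

minor-diagonal : ∀ x y u → minor x y u u ≡ 0ℚ
minor-diagonal x y u = ℚₚ.+-inverseʳ (x u * y u)

≼⇒0≤minor : ∀ {x y u v} → x ≼ y → u ℕ.≤ v → 0ℚ ≤ minor x y u v
≼⇒0≤minor {x} {y} {u} x≼y u≤v with ℕₚ.m≤n⇒m<n∨m≡n u≤v
... | inj₁ u<v  = x≼y u<v
... | inj₂ refl = ℚₚ.≤-reflexive (sym (minor-diagonal x y u))

≼-resp-≗ : ∀ {x x′ y y′} → x ≗ x′ → y ≗ y′ → x ≼ y → x′ ≼ y′
≼-resp-≗ {x} {x′} {y} {y′} x≗x′ y≗y′ x≼y {u} {v} u<v =
  subst (0ℚ ≤_) (cong₂ _-_ (cong₂ _*_ (x≗x′ u) (y≗y′ v)) (cong₂ _*_ (x≗x′ v) (y≗y′ u)))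
    (x≼y u<v)

≼-pointMass : ∀ {x y} → (∀ j → 0ℚ ≤ x j) → (∀ j → 0ℚ ≤ y j) →
              (∀ j → x (suc j) ≡ 0ℚ) → x ≼ y
≼-pointMass {x} {y} 0≤x 0≤y x₊≡0 {u} {suc v} _ = begin
  0ℚ                              ≤⟨ 0≤p*q (0≤x u) (0≤y (suc v)) ⟩
  x u * y (suc v)                 ≡⟨ solve 2 (λ a c → a := a :- con 0ℚ :* c) refl (x u * y (suc v)) (y u) ⟩
  x u * y (suc v) - 0ℚ * y u      ≡⟨ cong (λ z → x u * y (suc v) - z * y u) (x₊≡0 v) ⟨
  minor x y u (suc v)             ∎

inside-< : ∀ {d j} z → j ℕ.< d → inside d j z ≡ z
inside-< {d} {j} z j<d with j ℕ.<ᵇ d | ℕₚ.<⇒<ᵇ j<d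
... | true | _ = refl

inside-≥ : ∀ {d j} z → d ℕ.≤ j → inside d j z ≡ 0ℚ
inside-≥ {d} {j} z d≤j with j ℕ.<ᵇ d | ℕₚ.<ᵇ⇒< j d
... | false | _   = refl
... | true  | j<d = contradiction (j<d _) (ℕₚ.≤⇒≯ d≤j)

inside-nonNeg : ∀ {d j z} → 0ℚ ≤ z → 0ℚ ≤ inside d j z
inside-nonNeg {d} {j} 0≤z with j ℕ.<ᵇ d
... | true  = 0≤z
... | false = ℚₚ.≤-refl

-- The last two summands are the only minors whose indices can be in decreasing order.
minor-expansion : ∀ xu₋ xu₀ xu₊ yu₋ yu₀ yu₊ xv₋ xv₀ xv₊ yv₋ yv₀ yv₊ a₋ a₀ a₊ b₋ b₀ b₊ →
  (xu₀ * a₀ + xu₋ * a₋ + xu₊ * a₊) * (yv₀ * b₀ + yv₋ * b₋ + yv₊ * b₊)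
    - (xv₀ * b₀ + xv₋ * b₋ + xv₊ * b₊) * (yu₀ * a₀ + yu₋ * a₋ + yu₊ * a₊)
  ≡ (a₋ * b₋ * (xu₋ * yv₋ - xv₋ * yu₋) + a₋ * b₀ * (xu₋ * yv₀ - xv₀ * yu₋)
      + a₋ * b₊ * (xu₋ * yv₊ - xv₊ * yu₋) + a₀ * b₋ * (xu₀ * yv₋ - xv₋ * yu₀)
      + a₀ * b₊ * (xu₀ * yv₊ - xv₊ * yu₀) + a₊ * b₀ * (xu₊ * yv₀ - xv₀ * yu₊)
      + a₊ * b₊ * (xu₊ * yv₊ - xv₊ * yu₊))
    + (a₀ * b₀ * (xu₀ * yv₀ - xv₀ * yu₀) + a₊ * b₋ * (xu₊ * yv₋ - xv₋ * yu₊))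
minor-expansion = solve 18
  (λ xu₋ xu₀ xu₊ yu₋ yu₀ yu₊ xv₋ xv₀ xv₊ yv₋ yv₀ yv₊ a₋ a₀ a₊ b₋ b₀ b₊ →
    (xu₀ :* a₀ :+ xu₋ :* a₋ :+ xu₊ :* a₊) :* (yv₀ :* b₀ :+ yv₋ :* b₋ :+ yv₊ :* b₊)
      :- (xv₀ :* b₀ :+ xv₋ :* b₋ :+ xv₊ :* b₊) :* (yu₀ :* a₀ :+ yu₋ :* a₋ :+ yu₊ :* a₊)
    := (a₋ :* b₋ :* (xu₋ :* yv₋ :- xv₋ :* yu₋) :+ a₋ :* b₀ :* (xu₋ :* yv₀ :- xv₀ :* yu₋)
         :+ a₋ :* b₊ :* (xu₋ :* yv₊ :- xv₊ :* yu₋) :+ a₀ :* b₋ :* (xu₀ :* yv₋ :- xv₋ :* yu₀)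
         :+ a₀ :* b₊ :* (xu₀ :* yv₊ :- xv₊ :* yu₀) :+ a₊ :* b₀ :* (xu₊ :* yv₀ :- xv₀ :* yu₊)
         :+ a₊ :* b₊ :* (xu₊ :* yv₊ :- xv₊ :* yu₊))
       :+ (a₀ :* b₀ :* (xu₀ :* yv₀ :- xv₀ :* yu₀) :+ a₊ :* b₋ :* (xu₊ :* yv₋ :- xv₋ :* yu₊)))
  refl

-- One step of the birth–death chain on {0, …, d - 1} acting on distributions; mass reaching d is lost.
module Tridiagonal (d : ℕ) (stay up down : ℕ → ℚ) where

  rise : ℕ → ℚ
  rise zero    = 0ℚ
  rise (suc k) = up k

  step : (ℕ → ℚ) → (ℕ → ℚ)
  step x j = inside d j (x j * stay j + x (ℕ.pred j) * rise j + x (suc j) * down (suc j))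

  Supported : (ℕ → ℚ) → Set
  Supported x = ∀ {j} → d ℕ.≤ j → x j ≡ 0ℚ

  step-supported : ∀ x → Supported (step x)
  step-supported x = inside-≥ _

  step-unfold : ∀ x {j} → j ℕ.< d →
           step x j ≡ x j * stay j + x (ℕ.pred j) * rise j + x (suc j) * down (suc j)
  step-unfold x = inside-< _

  minor-outside : ∀ {x y u v} → Supported x → Supported y → d ℕ.≤ v → minor x y u v ≡ 0ℚ
  minor-outside {x} {y} {u} {v} sx sy d≤v = begin-equality
    x u * y v - x v * y u   ≡⟨ cong₂ (λ a b → x u * a - b * y u) (sy d≤v) (sx d≤v) ⟩
    x u * 0ℚ - 0ℚ * y u     ≡⟨ solve 2 (λ a b → a :* con 0ℚ :- con 0ℚ :* b := con 0ℚ) refl (x u) (y u) ⟩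
    0ℚ                      ∎

  step-last : ∀ {x m} → Supported x → suc m ≡ d → step x m ≡ x m * stay m + x (ℕ.pred m) * rise m
  step-last {x} {m} sx refl = begin-equality
    step x m                          ≡⟨ step-unfold x ℕₚ.≤-refl ⟩
    here + x (suc m) * down (suc m)   ≡⟨ cong (λ z → here + z * down (suc m)) (sx ℕₚ.≤-refl) ⟩
    here + 0ℚ * down (suc m)          ≡⟨ solve 2 (λ a c → a :+ con 0ℚ :* c := a) refl here (down (suc m)) ⟩
    here                              ∎
    where
    here : ℚ
    here = x m * stay m + x (ℕ.pred m) * rise m

  module NonNegativeKernel
    (0≤stay : ∀ {j} → j ℕ.< d → 0ℚ ≤ stay j)
    (0≤up   : ∀ {j} → suc j ℕ.< d → 0ℚ ≤ up j)
    (0≤down : ∀ {j} → suc j ℕ.< d → 0ℚ ≤ down (suc j))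
    where

    0≤rise : ∀ {j} → j ℕ.< d → 0ℚ ≤ rise j
    0≤rise {zero}  _ = ℚₚ.≤-refl
    0≤rise {suc k} = 0≤up

    0≤weighted : ∀ {x} → Supported x → (∀ j → 0ℚ ≤ x j) →
                 ∀ {j c} → (j ℕ.< d → 0ℚ ≤ c) → 0ℚ ≤ x j * c
    0≤weighted {x} sx 0≤x {j} {c} 0≤c with ℕₚ.<-≤-connex j d
    ... | inj₁ j<d = 0≤p*q (0≤x j) (0≤c j<d)
    ... | inj₂ d≤j = begin
      0ℚ      ≡⟨ ℚₚ.*-zeroˡ c ⟨
      0ℚ * c  ≡⟨ cong (_* c) (sx d≤j) ⟨
      x j * c ∎

    step-nonNeg : ∀ {x} → Supported x → (∀ j → 0ℚ ≤ x j) → ∀ j → 0ℚ ≤ step x j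
    step-nonNeg {x} sx 0≤x j with ℕₚ.<-≤-connex j d
    ... | inj₂ d≤j = ℚₚ.≤-reflexive (sym (step-supported x d≤j))
    ... | inj₁ j<d = subst (0ℚ ≤_) (sym (step-unfold x j<d))
      (0≤p+q (0≤p+q (0≤p*q (0≤x j) (0≤stay j<d)) (0≤p*q (0≤x _) (0≤rise j<d)))
             (0≤weighted sx 0≤x 0≤down))

    0≤minor-term : ∀ {x y u v a b} → Supported x → Supported y → x ≼ y → u ℕ.≤ v →
                   0ℚ ≤ a → (v ℕ.< d → 0ℚ ≤ b) → 0ℚ ≤ a * b * minor x y u v
    0≤minor-term {x} {y} {u} {v} {a} {b} sx sy x≼y u≤v 0≤a 0≤b with ℕₚ.<-≤-connex v d
    ... | inj₁ v<d = 0≤p*q (0≤p*q 0≤a (0≤b v<d)) (≼⇒0≤minor {x} {y} x≼y u≤v)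
    ... | inj₂ d≤v = begin
      0ℚ                    ≡⟨ ℚₚ.*-zeroʳ (a * b) ⟨
      a * b * 0ℚ            ≡⟨ cong (a * b *_) (minor-outside sx sy d≤v) ⟨
      a * b * minor x y u v ∎

    last-coordinate : ∀ {x y m} → suc m ≡ d → Supported x → Supported y → x ≼ y →
                      x m * step y m ≤ y m * step x m
    last-coordinate {x} {y} {m} m+1≡d sx sy x≼y = 0≤q-p⇒p≤q (begin
      0ℚ
        ≤⟨ 0≤p*q (0≤rise (ℕₚ.≤-reflexive m+1≡d)) (≼⇒0≤minor {x} {y} x≼y ℕₚ.pred[n]≤n) ⟩
      rise m * minor x y (ℕ.pred m) m
        ≡⟨ identity (y m) (x m) (stay m) (rise m) (x (ℕ.pred m)) (y (ℕ.pred m)) ⟨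
      y m * (x m * stay m + x (ℕ.pred m) * rise m) - x m * (y m * stay m + y (ℕ.pred m) * rise m)
        ≡⟨ cong₂ (λ a b → y m * a - x m * b) (step-last sx m+1≡d) (step-last sy m+1≡d) ⟨
      y m * step x m - x m * step y m ∎)
      where
      identity : ∀ Y X a r x₋ y₋ → Y * (X * a + x₋ * r) - X * (Y * a + y₋ * r) ≡ r * (x₋ * Y - X * y₋)
      identity = solve 6 (λ Y X a r x₋ y₋ →
        Y :* (X :* a :+ x₋ :* r) :- X :* (Y :* a :+ y₋ :* r) := r :* (x₋ :* Y :- X :* y₋)) refl

    module TotallyPositiveKernel
      (adjacent-minor : ∀ {j} → suc j ℕ.< d → down (suc j) * up j ≤ stay j * stay (suc j))
      where

      -- For u = k the two minors are opposite, and the adjacent-minor condition absorbs the negative one.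
      0≤crossing-pair : ∀ {x y u k} → Supported x → Supported y → x ≼ y → u ℕ.≤ k → suc k ℕ.< d →
        0ℚ ≤ stay u * stay (suc k) * minor x y u (suc k) + down (suc u) * up k * minor x y (suc u) k
      0≤crossing-pair {x} {y} {u} {k} sx sy x≼y u≤k k+1<d with ℕₚ.m≤n⇒m<n∨m≡n u≤k
      ... | inj₁ u<k = 0≤p+q
        (0≤minor-term sx sy x≼y (ℕₚ.m≤n⇒m≤1+n u≤k) (0≤stay (ℕₚ.<-trans u<k k<d)) 0≤stay)
        (0≤minor-term sx sy x≼y u<k (0≤down (ℕₚ.≤-<-trans u<k k<d)) (λ _ → 0≤up k+1<d))
        where
        k<d : k ℕ.< d
        k<d = ℕₚ.<⇒≤ k+1<d
      ... | inj₂ refl = begin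
        0ℚ
          ≤⟨ 0≤p*q (p≤q⇒0≤q-p (adjacent-minor k+1<d)) (x≼y (ℕₚ.n<1+n u)) ⟩
        (stay u * stay (suc u) - down (suc u) * up u) * minor x y u (suc u)
          ≡⟨ identity (stay u * stay (suc u)) (down (suc u) * up u) (x u * y (suc u)) (x (suc u) * y u) ⟨
        stay u * stay (suc u) * minor x y u (suc u) + down (suc u) * up u * minor x y (suc u) u
          ∎
        where
        identity : ∀ A C p r → A * (p - r) + C * (r - p) ≡ (A - C) * (p - r)
        identity = solve 4 (λ A C p r → A :* (p :- r) :+ C :* (r :- p) := (A :- C) :* (p :- r)) refl

      step-preserves-≼ : ∀ {x y} → Supported x → Supported y → x ≼ y → step x ≼ step y
      step-preserves-≼ {x} {y} sx sy x≼y {u} {suc k} (ℕ.s≤s u≤k) with ℕₚ.<-≤-connex (suc k) d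
      ... | inj₂ d≤k+1 =
        ℚₚ.≤-reflexive (sym (minor-outside (step-supported x) (step-supported y) d≤k+1))
      ... | inj₁ k+1<d = begin
        0ℚ
          ≤⟨ 0≤p+q (0≤p+q (0≤p+q (0≤p+q (0≤p+q (0≤p+q (0≤p+q
               (term (ℕₚ.≤-trans ℕₚ.pred[n]≤n u≤k) 0≤a₋ (λ _ → 0≤b₋))
               (term (ℕₚ.≤-trans ℕₚ.pred[n]≤n (ℕₚ.m≤n⇒m≤1+n u≤k)) 0≤a₋ (λ _ → 0≤b₀)))
               (term (ℕₚ.≤-trans ℕₚ.pred[n]≤n (ℕₚ.m≤n⇒m≤1+n (ℕₚ.m≤n⇒m≤1+n u≤k))) 0≤a₋ 0≤down))
               (term u≤k 0≤a₀ (λ _ → 0≤b₋)))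
               (term (ℕₚ.m≤n⇒m≤1+n (ℕₚ.m≤n⇒m≤1+n u≤k)) 0≤a₀ 0≤down))
               (term (ℕ.s≤s u≤k) 0≤a₊ (λ _ → 0≤b₀)))
               (term (ℕ.s≤s (ℕₚ.m≤n⇒m≤1+n u≤k)) 0≤a₊ 0≤down))
             (0≤crossing-pair sx sy x≼y u≤k k+1<d) ⟩
        _ ≡⟨ minor-expansion (x (ℕ.pred u)) (x u) (x (suc u)) (y (ℕ.pred u)) (y u) (y (suc u))
                             (x k) (x (suc k)) (x (suc (suc k))) (y k) (y (suc k)) (y (suc (suc k)))
                             (rise u) (stay u) (down (suc u)) (up k) (stay (suc k)) (down (suc (suc k))) ⟨
        _ ≡⟨ cong₂ _-_ (cong₂ _*_ (step-unfold x u<d) (step-unfold y k+1<d))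
                       (cong₂ _*_ (step-unfold x k+1<d) (step-unfold y u<d)) ⟨
        minor (step x) (step y) u (suc k) ∎
        where
        u<d : u ℕ.< d
        u<d = ℕₚ.≤-<-trans u≤k (ℕₚ.<⇒≤ k+1<d)

        term : ∀ {u′ v′ a b} → u′ ℕ.≤ v′ → 0ℚ ≤ a → (v′ ℕ.< d → 0ℚ ≤ b) →
               0ℚ ≤ a * b * minor x y u′ v′
        term = 0≤minor-term sx sy x≼y

        0≤a₋ : 0ℚ ≤ rise u
        0≤a₋ = 0≤rise u<d

        0≤a₀ : 0ℚ ≤ stay u
        0≤a₀ = 0≤stay u<d

        0≤a₊ : 0ℚ ≤ down (suc u)
        0≤a₊ = 0≤down (ℕₚ.≤-<-trans (ℕ.s≤s u≤k) k+1<d)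

        0≤b₋ : 0ℚ ≤ up k
        0≤b₋ = 0≤up k+1<d

        0≤b₀ : 0ℚ ≤ stay (suc k)
        0≤b₀ = 0≤stay k+1<d

module RandomWalk (d : ℕ) (α β : ℕ → ℚ)
  (½≤α   : ∀ i → i ℕ.≤ d → ½ ≤ α i)
  (0<β   : ∀ i → i ℕ.< d → 0ℚ < β i)
  (α+β≤1 : ∀ i → i ℕ.< d → α i + β i ≤ 1ℚ)
  where

  γ : ℕ → ℚ
  γ i = 1ℚ - α i - β i

  open Tridiagonal d α β γ

  0≤α : ∀ {i} → i ℕ.< d → 0ℚ ≤ α i
  0≤α {i} i<d = ℚₚ.≤-trans (ℚₚ.nonNegative⁻¹ ½) (½≤α i (ℕₚ.<⇒≤ i<d))

  0≤β : ∀ {i} → i ℕ.< d → 0ℚ ≤ β i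
  0≤β {i} i<d = ℚₚ.<⇒≤ (0<β i i<d)

  0≤γ : ∀ {i} → i ℕ.< d → 0ℚ ≤ γ i
  0≤γ {i} i<d = p+q≤r⇒0≤r-p-q {α i} (α+β≤1 i i<d)

  1-α≤α : ∀ {i j} → i ℕ.≤ d → j ℕ.≤ d → 1ℚ - α i ≤ α j
  1-α≤α {i} {j} i≤d j≤d = ℚₚ.≤-trans (½≤p⇒1-p≤½ (½≤α i i≤d)) (½≤α j j≤d)

  γβ≤αα : ∀ {j} → suc j ℕ.< d → γ (suc j) * β j ≤ α j * α (suc j)
  γβ≤αα {j} j+1<d = *-mono-≤-nonNeg (0≤γ j+1<d) (0≤β j<d) γ≤α β≤α
    where
    j<d : j ℕ.< d
    j<d = ℕₚ.<⇒≤ j+1<d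

    γ≤α : γ (suc j) ≤ α j
    γ≤α = ℚₚ.≤-trans (0≤q⇒r-p-q≤r-p {α (suc j)} {r = 1ℚ} (0≤β j+1<d))
                     (1-α≤α (ℕₚ.<⇒≤ j+1<d) (ℕₚ.<⇒≤ j<d))

    β≤α : β j ≤ α (suc j)
    β≤α = ℚₚ.≤-trans (p+q≤r⇒q≤r-p {α j} (α+β≤1 j j<d)) (1-α≤α (ℕₚ.<⇒≤ j<d) (ℕₚ.<⇒≤ j+1<d))

  open NonNegativeKernel 0≤α (λ j+1<d → 0≤β (ℕₚ.<⇒≤ j+1<d)) 0≤γ
  open TotallyPositiveKernel γβ≤αα

  taboo : ℕ → ℕ → ℚ
  taboo = q d α β

  taboo-step : ∀ t → taboo (suc t) ≗ step (taboo t)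
  taboo-step t zero    =
    cong (λ z → inside d 0 (taboo t 0 * α 0 + z + taboo t 1 * γ 1)) (sym (ℚₚ.*-zeroʳ (taboo t 0)))
  taboo-step t (suc k) = refl

  taboo-supported : ∀ t → Supported (taboo t)
  taboo-supported zero    {zero}  = inside-≥ 1ℚ
  taboo-supported zero    {suc j} = λ _ → refl
  taboo-supported (suc t)         = inside-≥ _

  0≤taboo : ∀ t j → 0ℚ ≤ taboo t j
  0≤taboo zero    zero    = inside-nonNeg {d} {0} (ℚₚ.nonNegative⁻¹ 1ℚ)
  0≤taboo zero    (suc j) = ℚₚ.≤-refl
  0≤taboo (suc t) j       =
    subst (0ℚ ≤_) (sym (taboo-step t j)) (step-nonNeg (taboo-supported t) (0≤taboo t) j)

  taboo-≼-suc : ∀ t → taboo t ≼ taboo (suc t)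
  taboo-≼-suc zero    = ≼-pointMass (0≤taboo 0) (0≤taboo 1) (λ _ → refl)
  taboo-≼-suc (suc t) = ≼-resp-≗ (sym ∘ taboo-step t) (sym ∘ taboo-step (suc t))
    (step-preserves-≼ (taboo-supported t) (taboo-supported (suc t)) (taboo-≼-suc t))

  taboo-log-concave-at-last : ∀ {m} → suc m ≡ d → ∀ t →
    taboo t m * taboo (suc (suc t)) m ≤ taboo (suc t) m * taboo (suc t) m
  taboo-log-concave-at-last {m} m+1≡d t = subst₂ (λ a b → taboo t m * a ≤ taboo (suc t) m * b)
    (sym (taboo-step (suc t) m)) (sym (taboo-step t m))
    (last-coordinate m+1≡d (taboo-supported t) (taboo-supported (suc t)) (taboo-≼-suc t))

mainTheorem8 : (d : ℕ) (α β : ℕ → ℚ) →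
    (∀ i → i Data.Nat.≤ d → ½ ≤ α i) →
    (∀ i → i Data.Nat.≤ d → α i ≤ 1ℚ) →
    (∀ i → i Data.Nat.< d → 0ℚ < β i) →
    (∀ i → i Data.Nat.< d → α i + β i ≤ 1ℚ) →
    (0 Data.Nat.< d → α 0 + β 0 ≡ 1ℚ) →
    LogConcave (firstPassage d α β)
mainTheorem8 zero    α β _ _ _ _ _ zero    = ℚₚ.≤-refl
mainTheorem8 zero    α β _ _ _ _ _ (suc t) = ℚₚ.≤-refl
mainTheorem8 (suc m) α β ½≤α _ 0<β α+β≤1 _ zero = begin
  0ℚ * (taboo 1 m * β m)               ≡⟨ ℚₚ.*-zeroˡ (taboo 1 m * β m) ⟩
  0ℚ                                   ≤⟨ 0≤p*q 0≤f₁ 0≤f₁ ⟩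
  taboo 0 m * β m * (taboo 0 m * β m)  ∎
  where
  open RandomWalk (suc m) α β ½≤α 0<β α+β≤1
  0≤f₁ : 0ℚ ≤ taboo 0 m * β m
  0≤f₁ = 0≤p*q (0≤taboo 0 m) (0≤β ℕₚ.≤-refl)
mainTheorem8 (suc m) α β ½≤α _ 0<β α+β≤1 _ (suc t) =
  subst₂ _≤_ (interchange (taboo t m) (taboo (suc (suc t)) m))
             (interchange (taboo (suc t) m) (taboo (suc t) m))
    (ℚₚ.*-monoʳ-≤-nonNeg (β m * β m) {{nonNegative (0≤p*q 0≤βm 0≤βm)}}
      (taboo-log-concave-at-last refl t))
  where
  open RandomWalk (suc m) α β ½≤α 0<β α+β≤1
  0≤βm : 0ℚ ≤ β m
  0≤βm = 0≤β ℕₚ.≤-refl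
  interchange : ∀ a c → a * c * (β m * β m) ≡ a * β m * (c * β m)
  interchange a c = solve 3 (λ a c b → a :* c :* (b :* b) := a :* b :* (c :* b)) refl a c (β m)
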